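{- For any $\Phi\in\mathrm{End}(\mathcal{Q})$ and $n\ge0$, the eigenvalues of $\Phi_n$, counted with multiplicity, are $(\lambda_\alpha)_{\alpha\in\operatorname{Comp}(n)}$.
   Context: Work over $\mathbb{Q}$. Compositions $\alpha=(a_1,\dots,a_k)$ of $n$ (positive integers summing to $n$), $\operatorname{Comp}(n)$, $(m)$ the one-part composition of $m$. $M_\alpha=\sum_{i_1<\dots<i_k}x_{i_1}^{a_1}\cdots x_{i_k}^{a_k}$, $\mathcal{Q}_n$ the span of $\{M_\alpha\}_{\alpha\in\operatorname{Comp}(n)}$, $\mathcal{Q}=\bigoplus\mathcal{Q}_n$ the graded Hopf algebra of quasisymmetric functions with coproduct $\Delta(M_\alpha)=\sum_{\alpha=\beta\cdot\gamma}M_\beta\otimes M_\gamma$. $\mathrm{End}(\mathcal{Q})$ = graded Hopf algebra endomorphisms, $\Phi_n=\Phi|_{\mathcal{Q}_n}$. For $\Phi\in\mathrm{End}(\mathcal{Q})$ let $\lambda_m=\Phi(M_{(m)})(1,0,0,\dots)$ (the value at $x_1=1$, $x_i=0$ for $i\ge2$), and $\lambda_\alpha=\lambda_{a_1}\cdots\lambda_{a_k}$. -}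

module Defs where

open import Data.Nat using (ℕ; zero; suc; _<_)
open import Data.Nat.Properties using () renaming (_≟_ to _≟ℕ_)
open import Data.Integer using (+_)
open import Data.Rational using (ℚ; 0ℚ; 1ℚ; _+_; _*_; _-_; -_; _/_)
open import Data.List using (List; []; _∷_; _++_; map; foldr; length; lookup)
open import Data.List.Properties using (≡-dec)
open import Data.List.Relation.Unary.All using (All)
open import Data.Fin using (Fin; zero; suc; _≟_)
open import Data.Product using (_×_; _,_)
open import Relation.Binary.PropositionalEquality using (_≡_)
open import Relation.Nullary using (yes; no)
open import Data.Empty using (⊥)

IsComp : List ℕ → Set
IsComp α = All (0 <_) α

size : List ℕ → ℕ
size = foldr Data.Nat._+_ 0

incHead : List ℕ → List ℕ
incHead []       = []
incHead (a ∷ as) = suc a ∷ as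

-- comps n : an enumeration (without repetition) of Comp(n).
-- A composition of n+2 either has first part 1 (followed by a
-- composition of n+1) or arises from a composition of n+1 by
-- increasing its first part.
comps : ℕ → List (List ℕ)
comps zero          = [] ∷ []
comps (suc zero)    = (1 ∷ []) ∷ []
comps (suc (suc n)) = map (1 ∷_) (comps (suc n)) ++ map incHead (comps (suc n))

sumℚ : List ℚ → ℚ
sumℚ = foldr _+_ 0ℚ

prodℚ : List ℚ → ℚ
prodℚ = foldr _*_ 1ℚ

Σ[_]_ : {A : Set} → List A → (A → ℚ) → ℚ
Σ[ xs ] f = sumℚ (map f xs)

Π[_]_ : {A : Set} → List A → (A → ℚ) → ℚ
Π[ xs ] f = prodℚ (map f xs)

ℕtoℚ : ℕ → ℚ
ℕtoℚ k = (+ k) / 1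

-- quasi-shuffles (with multiplicity): M_β M_γ = Σ_{δ ∈ qsh β γ} M_δ
qsh : List ℕ → List ℕ → List (List ℕ)
qsh []       ys       = ys ∷ []
qsh (x ∷ xs) []       = (x ∷ xs) ∷ []
qsh (x ∷ xs) (y ∷ ys) =
  map (x ∷_) (qsh xs (y ∷ ys)) ++ map (y ∷_) (qsh (x ∷ xs) ys)
    ++ map ((x Data.Nat.+ y) ∷_) (qsh xs ys)

countOcc : List ℕ → List (List ℕ) → ℕ
countOcc α []       = 0
countOcc α (δ ∷ δs) with ≡-dec _≟ℕ_ α δ
... | yes _ = suc (countOcc α δs)
... | no  _ = countOcc α δs

prodCoeff : List ℕ → List ℕ → List ℕ → ℚ
prodCoeff α β γ = ℕtoℚ (countOcc α (qsh β γ))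

-- deconcatenations: Δ M_α = Σ_{(β,γ) ∈ splits α} M_β ⊗ M_γ
splits : List ℕ → List (List ℕ × List ℕ)
splits []       = ([] , []) ∷ []
splits (x ∷ xs) = ([] , x ∷ xs) ∷ map (λ { (a , b) → (x ∷ a , b) }) (splits xs)

-- A linear map Φ : 𝒬 → 𝒬 is given by its matrix in the M-basis:
--   Φ(M_β) = Σ_α φ α β · M_α   (only values on compositions matter).

ε : List ℕ → ℚ
ε []      = 1ℚ
ε (_ ∷ _) = 0ℚ

-- graded Hopf algebra endomorphism (= graded bialgebra endomorphism;
-- the antipode is automatically preserved)
record IsGradedHopfEnd (φ : List ℕ → List ℕ → ℚ) : Set where
  field
    graded : ∀ α β → IsComp α → IsComp β → (size α ≡ size β → ⊥) → φ α β ≡ 0ℚ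
    unit   : φ [] [] ≡ 1ℚ
    -- Φ(M_β M_γ) = Φ(M_β) Φ(M_γ), compared coefficientwise at M_α
    mult   : ∀ α β γ → IsComp α → IsComp β → IsComp γ →
             Σ[ qsh β γ ] (λ δ → φ α δ)
               ≡ Σ[ comps (size β) ] (λ α₁ → Σ[ comps (size γ) ] (λ α₂ →
                   (φ α₁ β * φ α₂ γ) * prodCoeff α α₁ α₂))
    -- Δ(Φ(M_β)) = (Φ ⊗ Φ)(Δ M_β), compared coefficientwise at M_ρ ⊗ M_σ
    comult : ∀ ρ σ β → IsComp ρ → IsComp σ → IsComp β →
             φ (ρ ++ σ) β
               ≡ Σ[ splits β ] (λ { (β₁ , β₂) → φ ρ β₁ * φ σ β₂ })
    counit : ∀ β → IsComp β → φ [] β ≡ ε β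

-- Evaluation at x₁ = 1, xᵢ = 0 (i ≥ 2):  M_α(1,0,0,…) = 1 if ℓ(α) ≤ 1, else 0

evalAt1 : List ℕ → ℚ
evalAt1 []           = 1ℚ
evalAt1 (_ ∷ [])     = 1ℚ
evalAt1 (_ ∷ _ ∷ _)  = 0ℚ

-- λ_m = Φ(M_(m))(1,0,0,…)
lam : (List ℕ → List ℕ → ℚ) → ℕ → ℚ
lam φ m = Σ[ comps m ] (λ α → φ α (m ∷ []) * evalAt1 α)

lamComp : (List ℕ → List ℕ → ℚ) → List ℕ → ℚ
lamComp φ α = Π[ α ] (lam φ)

Matrix : ℕ → Set
Matrix k = Fin k → Fin k → ℚ

minor : ∀ {k} → Matrix (suc k) → Fin (suc k) → Matrix k
minor A j r c = A (suc r) (Data.Fin.punchIn j c)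

sign : ℕ → ℚ
sign zero          = 1ℚ
sign (suc zero)    = - 1ℚ
sign (suc (suc i)) = sign i

det : ∀ {k} → Matrix k → ℚ
det {zero}  A = 1ℚ
det {suc k} A = Σ[ Data.List.allFin (suc k) ] (λ j →
                  (sign (Data.Fin.toℕ j) * A zero j) * det (minor A j))

δ : ∀ {k} → Fin k → Fin k → ℚ
δ i j with i ≟ j
... | yes _ = 1ℚ
... | no  _ = 0ℚ

matΦ : (List ℕ → List ℕ → ℚ) → (n : ℕ) → Matrix (length (comps n))
matΦ φ n i j = φ (lookup (comps n) i) (lookup (comps n) j)

charPoly : (List ℕ → List ℕ → ℚ) → ℕ → ℚ → ℚ
charPoly φ n t = det (λ i j → t * δ i j - matΦ φ n i j)

-- Order compositions lexicographically; `comps n` lists Comp(n) in increasing order.  By comultiplicativity, the coefficient φ (a ∷ σ) τ is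
-- a sum over the deconcatenations τ = β₁ · β₂ of φ (a) β₁ · φ σ β₂, and by gradedness
-- only the β₁ of size a contribute.  Hence φ (a ∷ σ) (b ∷ τ) vanishes for a < b and
-- equals φ (a) (a) · φ σ τ for a = b, while the counit kills φ [] β for β ≠ [].  So the
-- matrix of Φ_n is triangular with diagonal entries φ α α = λ_α, because λ_a = φ (a) (a)
-- (only the one-part composition survives the evaluation at (1,0,0,…)).
module Submission where

open import Defs
open import Data.Nat using (ℕ; zero; suc; _<_; _≤_; s≤s; z≤n)
open import Data.Nat.Properties
  using (+-identityʳ; <-irrefl; <-trans; <⇒≤; <-≤-trans; ≤-<-trans; ≤-refl; m≤m+n; m<m+n; +-monoʳ-≤; <⇒≢)
open import Data.List using (List; []; _∷_; _++_; map; tabulate; length; lookup; allFin)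
open import Data.List.Properties using (map-tabulate; tabulate-lookup)
open import Data.List.Membership.Propositional.Properties using (∈-lookup)
open import Data.List.Relation.Unary.All as All using (All; []; _∷_)
import Data.List.Relation.Unary.All.Properties as All
open import Data.List.Relation.Unary.AllPairs as AllPairs using (AllPairs; []; _∷_)
import Data.List.Relation.Unary.AllPairs.Properties as AllPairs
open import Data.List.Relation.Binary.Lex.Core using (Lex-<; halt; this; next)
open import Data.Fin using (Fin) renaming (zero to fzero; suc to fsuc)
import Data.Fin as Fin
open import Data.Rational using (ℚ; 0ℚ; 1ℚ; _+_; _*_; _-_)
open import Data.Rational.Properties
  using (+-identityˡ; +-assoc; *-identityˡ; *-identityʳ; *-zeroˡ; *-zeroʳ; +-inverseʳ)
  renaming (+-identityʳ to +-identityʳ-ℚ)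
open import Data.Product using (_×_; _,_; proj₁)
open import Data.Empty using (⊥-elim)
open import Function using (_∘_)
open import Level using (0ℓ)
open import Relation.Binary.Core using (Rel)
open import Relation.Binary.PropositionalEquality
  using (_≡_; _≢_; refl; sym; trans; cong; cong₂)
open import Relation.Nullary using (yes; no)
open Relation.Binary.PropositionalEquality.≡-Reasoning

module _ {A : Set} where

  Σ-cong : (xs : List A) {f g : A → ℚ} → (∀ x → f x ≡ g x) → Σ[ xs ] f ≡ Σ[ xs ] g
  Σ-cong []       f≗g = refl
  Σ-cong (x ∷ xs) f≗g = cong₂ _+_ (f≗g x) (Σ-cong xs f≗g)

  Π-cong : (xs : List A) {f g : A → ℚ} → (∀ x → f x ≡ g x) → Π[ xs ] f ≡ Π[ xs ] g
  Π-cong []       f≗g = refl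
  Π-cong (x ∷ xs) f≗g = cong₂ _*_ (f≗g x) (Π-cong xs f≗g)

  Σ-zero : (xs : List A) {f : A → ℚ} → All (λ x → f x ≡ 0ℚ) xs → Σ[ xs ] f ≡ 0ℚ
  Σ-zero []       []         = refl
  Σ-zero (x ∷ xs) (fx≡0 ∷ p) = trans (cong₂ _+_ fx≡0 (Σ-zero xs p)) (+-identityˡ 0ℚ)

  Σ-++ : (xs ys : List A) (f : A → ℚ) → Σ[ xs ++ ys ] f ≡ Σ[ xs ] f + Σ[ ys ] f
  Σ-++ []       ys f = sym (+-identityˡ _)
  Σ-++ (x ∷ xs) ys f = trans (cong (f x +_) (Σ-++ xs ys f)) (sym (+-assoc (f x) _ _))

  Σ-map : {B : Set} (h : B → A) (xs : List B) (f : A → ℚ) →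
          Σ[ map h xs ] f ≡ Σ[ xs ] (f ∘ h)
  Σ-map h []       f = refl
  Σ-map h (x ∷ xs) f = cong (f (h x) +_) (Σ-map h xs f)

  Π-allFin-lookup : (xs : List A) (g : A → ℚ) →
                    Π[ allFin (length xs) ] (g ∘ lookup xs) ≡ Π[ xs ] g
  Π-allFin-lookup xs g = cong prodℚ (begin
    map (g ∘ lookup xs) (allFin (length xs)) ≡⟨ map-tabulate (λ i → i) (g ∘ lookup xs) ⟩
    tabulate (g ∘ lookup xs)                 ≡⟨ map-tabulate (lookup xs) g ⟨
    map g (tabulate (lookup xs))             ≡⟨ cong (map g) (tabulate-lookup xs) ⟩
    map g xs                                 ∎)

map-allFin-suc : ∀ {k} {B : Set} (f : Fin (suc k) → B) →
                 map f (allFin (suc k)) ≡ f fzero ∷ map (f ∘ fsuc) (allFin k)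
map-allFin-suc f =
  cong (f fzero ∷_) (trans (map-tabulate fsuc f) (sym (map-tabulate (λ i → i) (f ∘ fsuc))))

det-lowerTriangular : ∀ {k} (A : Matrix k) → (∀ i j → i Fin.< j → A i j ≡ 0ℚ) →
                      det A ≡ Π[ allFin k ] (λ i → A i i)
det-lowerTriangular {zero}  A upper≡0 = refl
det-lowerTriangular {suc k} A upper≡0 = begin
  det A
    ≡⟨ cong sumℚ (map-allFin-suc term) ⟩
  term fzero + Σ[ allFin k ] (term ∘ fsuc)
    ≡⟨ cong₂ _+_ first-term (Σ-zero (allFin k) (All.tabulate⁺ later-term)) ⟩
  A fzero fzero * Π[ allFin k ] (λ i → A (fsuc i) (fsuc i)) + 0ℚ
    ≡⟨ +-identityʳ-ℚ _ ⟩
  A fzero fzero * Π[ allFin k ] (λ i → A (fsuc i) (fsuc i))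
    ≡⟨ cong prodℚ (map-allFin-suc (λ i → A i i)) ⟨
  Π[ allFin (suc k) ] (λ i → A i i) ∎
  where
  term : Fin (suc k) → ℚ
  term j = (sign (Fin.toℕ j) * A fzero j) * det (minor A j)

  first-term : term fzero ≡ A fzero fzero * Π[ allFin k ] (λ i → A (fsuc i) (fsuc i))
  first-term = cong₂ _*_ (*-identityˡ (A fzero fzero))
    (det-lowerTriangular (minor A fzero) (λ i j i<j → upper≡0 (fsuc i) (fsuc j) (s≤s i<j)))

  later-term : ∀ j → term (fsuc j) ≡ 0ℚ
  later-term j = begin
    (sign (Fin.toℕ (fsuc j)) * A fzero (fsuc j)) * det (minor A (fsuc j))
      ≡⟨ cong (λ a → (sign (Fin.toℕ (fsuc j)) * a) * det (minor A (fsuc j)))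
              (upper≡0 fzero (fsuc j) (s≤s z≤n)) ⟩
    (sign (Fin.toℕ (fsuc j)) * 0ℚ) * det (minor A (fsuc j))
      ≡⟨ cong (_* det (minor A (fsuc j))) (*-zeroʳ (sign (Fin.toℕ (fsuc j)))) ⟩
    0ℚ * det (minor A (fsuc j))
      ≡⟨ *-zeroˡ (det (minor A (fsuc j))) ⟩
    0ℚ ∎

δ-refl : ∀ {k} (i : Fin k) → δ i i ≡ 1ℚ
δ-refl i with i Fin.≟ i
... | yes _  = refl
... | no i≢i = ⊥-elim (i≢i refl)

δ-< : ∀ {k} {i j : Fin k} → i Fin.< j → δ i j ≡ 0ℚ
δ-< {i = i} {j} i<j with i Fin.≟ j
... | yes refl = ⊥-elim (<-irrefl refl i<j)
... | no _     = refl

AllPairs-lookup : {A : Set} {R : Rel A 0ℓ} {xs : List A} → AllPairs R xs →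
                  ∀ {i j} → i Fin.< j → R (lookup xs i) (lookup xs j)
AllPairs-lookup (Rx ∷ _)  {fzero}  {fsuc j} _         = All.lookup Rx (∈-lookup j)
AllPairs-lookup (_ ∷ Rxs) {fsuc i} {fsuc j} (s≤s i<j) = AllPairs-lookup Rxs i<j

_<ₗₑₓ_ : Rel (List ℕ) 0ℓ
_<ₗₑₓ_ = Lex-< _≡_ _<_

IsCompOf : ℕ → List ℕ → Set
IsCompOf n α = IsComp α × size α ≡ n

comps-sound : ∀ n → All (IsCompOf n) (comps n)
comps-sound zero          = ([] , refl) ∷ []
comps-sound (suc zero)    = (s≤s z≤n ∷ [] , refl) ∷ []
comps-sound (suc (suc k)) =
  All.++⁺ (All.map⁺ (All.map cons-one (comps-sound (suc k))))
          (All.map⁺ (All.map inc-head (comps-sound (suc k))))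
  where
  cons-one : ∀ {α} → IsCompOf (suc k) α → IsCompOf (suc (suc k)) (1 ∷ α)
  cons-one (α-comp , size≡) = s≤s z≤n ∷ α-comp , cong suc size≡

  inc-head : ∀ {α} → IsCompOf (suc k) α → IsCompOf (suc (suc k)) (incHead α)
  inc-head {_ ∷ _} (_ ∷ α-comp , size≡) = s≤s z≤n ∷ α-comp , cong suc size≡

incHead-mono : ∀ {α β} → α <ₗₑₓ β → incHead α <ₗₑₓ incHead β
incHead-mono halt             = halt
incHead-mono (this a<b)       = this (s≤s a<b)
incHead-mono (next refl α<β) = next refl α<β

comps-sorted : ∀ n → AllPairs _<ₗₑₓ_ (comps n)
comps-sorted zero          = [] ∷ []
comps-sorted (suc zero)    = [] ∷ []
comps-sorted (suc (suc k)) =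
  AllPairs.++⁺ (AllPairs.map⁺ (AllPairs.map (next refl) (comps-sorted (suc k))))
               (AllPairs.map⁺ (AllPairs.map incHead-mono (comps-sorted (suc k))))
               (All.map⁺ (All.universal (λ _ →
                  All.map⁺ (All.map one-<-incHead (comps-sound (suc k)))) _))
  where
  one-<-incHead : ∀ {α β} → IsCompOf (suc k) β → (1 ∷ α) <ₗₑₓ incHead β
  one-<-incHead {β = b ∷ _} (0<b ∷ _ , _) = this (s≤s 0<b)

Σ-comps-evalAt1 : ∀ k (g : List ℕ → ℚ) →
                  Σ[ comps (suc k) ] (λ α → g α * evalAt1 α) ≡ g (suc k ∷ [])
Σ-comps-evalAt1 zero    g = trans (+-identityʳ-ℚ _) (*-identityʳ _)
Σ-comps-evalAt1 (suc k) g = begin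
  Σ[ map (1 ∷_) cs ++ map incHead cs ] term
    ≡⟨ Σ-++ (map (1 ∷_) cs) _ term ⟩
  Σ[ map (1 ∷_) cs ] term + Σ[ map incHead cs ] term
    ≡⟨ cong₂ _+_ (trans (Σ-map (1 ∷_) cs term)
                        (Σ-zero cs (All.map one-∷-term (comps-sound (suc k)))))
                 (trans (Σ-map incHead cs term)
                        (Σ-cong cs (λ α → cong (g (incHead α) *_) (evalAt1-incHead α)))) ⟩
  0ℚ + Σ[ cs ] (λ α → g (incHead α) * evalAt1 α)
    ≡⟨ +-identityˡ _ ⟩
  Σ[ cs ] (λ α → g (incHead α) * evalAt1 α)
    ≡⟨ Σ-comps-evalAt1 k (g ∘ incHead) ⟩
  g (suc (suc k) ∷ []) ∎
  where
  cs : List (List ℕ)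
  cs = comps (suc k)

  term : List ℕ → ℚ
  term α = g α * evalAt1 α

  one-∷-term : ∀ {α} → IsCompOf (suc k) α → term (1 ∷ α) ≡ 0ℚ
  one-∷-term {α@(_ ∷ _)} _ = *-zeroʳ (g (1 ∷ α))

  evalAt1-incHead : ∀ α → evalAt1 (incHead α) ≡ evalAt1 α
  evalAt1-incHead []          = refl
  evalAt1-incHead (_ ∷ [])    = refl
  evalAt1-incHead (_ ∷ _ ∷ _) = refl

lam-suc : ∀ φ k → lam φ (suc k) ≡ φ (suc k ∷ []) (suc k ∷ [])
lam-suc φ k = Σ-comps-evalAt1 k (λ α → φ α (suc k ∷ []))

Homogeneous : ℕ → (List ℕ → ℚ) → Set
Homogeneous a w = ∀ β → IsComp β → size β ≢ a → w β ≡ 0ℚ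

splitTerm : (List ℕ → ℚ) → (List ℕ → ℚ) → List ℕ × List ℕ → ℚ
splitTerm w g (β₁ , β₂) = w β₁ * g β₂

splits-isComp : ∀ {τ} → IsComp τ → All (IsComp ∘ proj₁) (splits τ)
splits-isComp []             = [] ∷ []
splits-isComp (0<x ∷ τ-comp) = [] ∷ All.map⁺ (All.map (0<x ∷_) (splits-isComp τ-comp))

Σ-splits-homogeneous : ∀ {a b τ} (w g : List ℕ → ℚ) → 0 < a → a ≤ b → Homogeneous a w →
                       IsComp (b ∷ τ) → Σ[ splits (b ∷ τ) ] (splitTerm w g) ≡ w (b ∷ []) * g τ
Σ-splits-homogeneous {a} {b} {τ} w g 0<a a≤b w-hom (0<b ∷ τ-comp) = begin
  w [] * g (b ∷ τ) + Σ[ map _ (splits τ) ] (splitTerm w g)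
    ≡⟨ cong₂ _+_ (trans (cong (_* g (b ∷ τ)) w[]≡0) (*-zeroˡ (g (b ∷ τ))))
                 (Σ-map _ (splits τ) (splitTerm w g)) ⟩
  0ℚ + Σ[ splits τ ] (splitTerm (w ∘ (b ∷_)) g)
    ≡⟨ +-identityˡ _ ⟩
  Σ[ splits τ ] (splitTerm (w ∘ (b ∷_)) g)
    ≡⟨ tail-sum τ-comp ⟩
  w (b ∷ []) * g τ ∎
  where
  w[]≡0 : w [] ≡ 0ℚ
  w[]≡0 = w-hom [] [] (<⇒≢ 0<a)

  tail-sum : ∀ {τ} → IsComp τ → Σ[ splits τ ] (splitTerm (w ∘ (b ∷_)) g) ≡ w (b ∷ []) * g τ
  tail-sum []                     = +-identityʳ-ℚ _
  tail-sum {x ∷ τ} (0<x ∷ τ-comp) = begin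
    w (b ∷ []) * g (x ∷ τ) + Σ[ map _ (splits τ) ] (splitTerm (w ∘ (b ∷_)) g)
      ≡⟨ cong (w (b ∷ []) * g (x ∷ τ) +_)
              (trans (Σ-map _ (splits τ) (splitTerm (w ∘ (b ∷_)) g))
                     (Σ-zero (splits τ) (All.map long-prefix (splits-isComp τ-comp)))) ⟩
    w (b ∷ []) * g (x ∷ τ) + 0ℚ
      ≡⟨ +-identityʳ-ℚ _ ⟩
    w (b ∷ []) * g (x ∷ τ) ∎
    where
    long-prefix : ∀ {β} → IsComp (proj₁ β) → splitTerm (w ∘ (λ γ → b ∷ x ∷ γ)) g β ≡ 0ℚ
    long-prefix {β₁ , β₂} β₁-comp =
      trans (cong (_* g β₂) (w-hom _ (0<b ∷ 0<x ∷ β₁-comp) size≢a)) (*-zeroˡ (g β₂))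
      where
      size≢a : size (b ∷ x ∷ β₁) ≢ a
      size≢a e = <⇒≢ (≤-<-trans a≤b (<-≤-trans (m<m+n b 0<x) (+-monoʳ-≤ b (m≤m+n x (size β₁)))))
                     (sym e)

module _ {φ : List ℕ → List ℕ → ℚ} (H : IsGradedHopfEnd φ) where
  open IsGradedHopfEnd H

  φ-single-homogeneous : ∀ {a} → 0 < a → Homogeneous a (φ (a ∷ []))
  φ-single-homogeneous {a} 0<a β β-comp size≢a =
    graded (a ∷ []) β (0<a ∷ []) β-comp (λ e → size≢a (trans (sym e) (+-identityʳ a)))

  φ-cons-cons : ∀ {a b σ τ} → 0 < a → a ≤ b → IsComp σ → IsComp (b ∷ τ) →
                φ (a ∷ σ) (b ∷ τ) ≡ φ (a ∷ []) (b ∷ []) * φ σ τ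
  φ-cons-cons {a} {b} {σ} {τ} 0<a a≤b σ-comp bτ-comp = begin
    φ (a ∷ σ) (b ∷ τ)
      ≡⟨ comult (a ∷ []) σ (b ∷ τ) (0<a ∷ []) σ-comp bτ-comp ⟩
    Σ[ splits (b ∷ τ) ] (splitTerm (φ (a ∷ [])) (φ σ))
      ≡⟨ Σ-splits-homogeneous (φ (a ∷ [])) (φ σ) 0<a a≤b (φ-single-homogeneous 0<a) bτ-comp ⟩
    φ (a ∷ []) (b ∷ []) * φ σ τ ∎

  φ-lex-zero : ∀ {α β} → IsComp α → IsComp β → α <ₗₑₓ β → φ α β ≡ 0ℚ
  φ-lex-zero []             β-comp  halt = counit _ β-comp
  φ-lex-zero (0<a ∷ σ-comp) bτ-comp (this {x = a} {σ} {b} {τ} a<b) = begin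
    φ (a ∷ σ) (b ∷ τ)               ≡⟨ φ-cons-cons 0<a (<⇒≤ a<b) σ-comp bτ-comp ⟩
    φ (a ∷ []) (b ∷ []) * φ σ τ     ≡⟨ cong (_* φ σ τ) (φ-single-homogeneous 0<a _ (0<b ∷ []) b≢a) ⟩
    0ℚ * φ σ τ                      ≡⟨ *-zeroˡ (φ σ τ) ⟩
    0ℚ                              ∎
    where
    0<b : 0 < b
    0<b = <-trans 0<a a<b
    b≢a : size (b ∷ []) ≢ a
    b≢a e = <⇒≢ a<b (trans (sym e) (+-identityʳ b))
  φ-lex-zero (0<a ∷ σ-comp) (_ ∷ τ-comp) (next {x = a} {σ} {_} {τ} refl σ<τ) = begin
    φ (a ∷ σ) (a ∷ τ)               ≡⟨ φ-cons-cons 0<a ≤-refl σ-comp (0<a ∷ τ-comp) ⟩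
    φ (a ∷ []) (a ∷ []) * φ σ τ     ≡⟨ cong (φ (a ∷ []) (a ∷ []) *_) (φ-lex-zero σ-comp τ-comp σ<τ) ⟩
    φ (a ∷ []) (a ∷ []) * 0ℚ        ≡⟨ *-zeroʳ (φ (a ∷ []) (a ∷ [])) ⟩
    0ℚ                              ∎

  φ-diagonal : ∀ {α} → IsComp α → φ α α ≡ lamComp φ α
  φ-diagonal []                         = unit
  φ-diagonal {suc k ∷ σ} (0<a ∷ σ-comp) = begin
    φ (suc k ∷ σ) (suc k ∷ σ)                   ≡⟨ φ-cons-cons 0<a ≤-refl σ-comp (0<a ∷ σ-comp) ⟩
    φ (suc k ∷ []) (suc k ∷ []) * φ σ σ         ≡⟨ cong₂ _*_ (sym (lam-suc φ k)) (φ-diagonal σ-comp) ⟩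
    lam φ (suc k) * lamComp φ σ                 ∎

proposition4p1 : (φ : List ℕ → List ℕ → ℚ) → IsGradedHopfEnd φ → (n : ℕ) →
    (t : ℚ) → charPoly φ n t ≡ Π[ comps n ] (λ α → t - lamComp φ α)
proposition4p1 φ H n t = begin
  det B
    ≡⟨ det-lowerTriangular B above-diagonal ⟩
  Π[ allFin (length cs) ] (λ i → B i i)
    ≡⟨ Π-cong (allFin (length cs)) on-diagonal ⟩
  Π[ allFin (length cs) ] ((t -_) ∘ lamComp φ ∘ lookup cs)
    ≡⟨ Π-allFin-lookup cs ((t -_) ∘ lamComp φ) ⟩
  Π[ cs ] (λ α → t - lamComp φ α) ∎
  where
  cs : List (List ℕ)
  cs = comps n

  B : Matrix (length cs)
  B i j = t * δ i j - matΦ φ n i j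

  comp-at : ∀ i → IsComp (lookup cs i)
  comp-at i = proj₁ (All.lookup (comps-sound n) (∈-lookup i))

  above-diagonal : ∀ i j → i Fin.< j → B i j ≡ 0ℚ
  above-diagonal i j i<j = begin
    t * δ i j - matΦ φ n i j ≡⟨ cong₂ _-_ (trans (cong (t *_) (δ-< i<j)) (*-zeroʳ t))
                                         (φ-lex-zero H (comp-at i) (comp-at j)
                                            (AllPairs-lookup (comps-sorted n) i<j)) ⟩
    0ℚ - 0ℚ                  ≡⟨ +-inverseʳ 0ℚ ⟩
    0ℚ                       ∎

  on-diagonal : ∀ i → B i i ≡ t - lamComp φ (lookup cs i)
  on-diagonal i = cong₂ _-_ (trans (cong (t *_) (δ-refl i)) (*-identityʳ t)) (φ-diagonal H (comp-at i))
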